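{- Let $n,w\ge 1$ and $n\ge k\ge 1$ be integers and $d=\gcd(n,k)$. Let $\mathrm{CDP}(n,w)$ be the set of integer sequences $(a_1,\dots,a_n)$ with $0\le a_i\le w-1$ and $a_{i+1}\le a_i+1$ for $1\le i\le n$ (where $a_{n+1}:=a_1$), and let $\mathrm{CDP}_k(n,w)$ be the subset of sequences fixed by cyclically shifting the sequence by $k$ positions. Then $|\mathrm{CDP}_k(n,w)|=|\mathrm{CDP}(d,w)|$. -}

module Defs where

open import Data.Nat using (ℕ; zero; suc; _+_; _≤_; NonZero)
open import Data.Nat.DivMod using (_%_; m%n<n)
open import Data.Fin using (Fin; toℕ; fromℕ<)
open import Data.Vec using (Vec; []; _∷_; lookup)
open import Data.List using (List; []; _∷_; map; concatMap; filter; length; allFin)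
open import Data.Product using (_×_)
open import Relation.Binary.PropositionalEquality using (_≡_)
open import Relation.Unary using (Pred; Decidable)
open import Relation.Nullary using (Dec)
open import Data.Nat.Properties using (_≤?_)
open import Data.Fin.Properties using (_≟_)
open import Data.Vec.Relation.Unary.All using () renaming (All to VAll)
open import Data.List.Relation.Unary.All using (All; all?)

allVecs : (n w : ℕ) → List (Vec (Fin w) n)
allVecs zero    w = [] ∷ []
allVecs (suc n) w = concatMap (λ x → map (x ∷_) (allVecs n w)) (allFin w)

shiftIdx : (n : ℕ) .{{_ : NonZero n}} → Fin n → ℕ → Fin n
shiftIdx n i j = fromℕ< (m%n<n (toℕ i + j) n)

IsCDP : (n w : ℕ) .{{_ : NonZero n}} → Vec (Fin w) n → Set
IsCDP n w a = All (λ i → toℕ (lookup a (shiftIdx n i 1)) ≤ suc (toℕ (lookup a i))) (allFin n)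

IsFixedBy : (n w k : ℕ) .{{_ : NonZero n}} → Vec (Fin w) n → Set
IsFixedBy n w k a = All (λ i → lookup a (shiftIdx n i k) ≡ lookup a i) (allFin n)

isCDP? : (n w : ℕ) .{{_ : NonZero n}} → Decidable (IsCDP n w)
isCDP? n w a = all? (λ i → toℕ (lookup a (shiftIdx n i 1)) ≤? suc (toℕ (lookup a i))) (allFin n)

isFixedBy? : (n w k : ℕ) .{{_ : NonZero n}} → Decidable (IsFixedBy n w k)
isFixedBy? n w k a = all? (λ i → lookup a (shiftIdx n i k) ≟ lookup a i) (allFin n)

cardCDP : (n w : ℕ) .{{_ : NonZero n}} → ℕ
cardCDP n w = length (filter (isCDP? n w) (allVecs n w))

cardCDPk : (n w k : ℕ) .{{_ : NonZero n}} → ℕ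
cardCDPk n w k = length (filter (isFixedBy? n w k) (filter (isCDP? n w) (allVecs n w)))

-- A vector a of length n is read as the n-periodic sequence  cyc a : ℕ → A.
-- Both defining conditions become statements about that sequence: being a
-- CDP says every term is at most one more than its predecessor, and being
-- fixed by the shift says the sequence is k-periodic.  A sequence that is
-- n- and k-periodic is gcd n k-periodic (Bézout), so a fixed CDP is
-- determined by its first d terms.  Hence  restrict  (keep the first d
-- terms) and  extend  (repeat a d-vector up to length n) are mutually
-- inverse between the two sets.  The counting step uses that duplicate-free
-- lists with the same members have the same length, applied to the list of
-- fixed CDPs and to the image of the list of d-CDPs under the injective map
-- extend.

module Submission where

open import Defs
open import Data.Nat using (ℕ; zero; suc; _+_; _*_; _≤_; NonZero)
open import Data.Nat.Properties using (+-assoc; +-comm; +-identityʳ)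
open import Data.Nat.DivMod using (_%_; _/_; m%n<n; m<n⇒m%n≡m; [m+n]%n≡m%n; m≡m%n+[m/n]*n)
open import Data.Nat.Divisibility using (_∣_; divides)
open import Data.Nat.GCD using (gcd; gcd[m,n]∣m; gcd[m,n]∣n; gcd-GCD; module Bézout)
open import Data.Fin using (Fin; toℕ; fromℕ<)
open import Data.Fin.Properties using (fromℕ<-cong; fromℕ<-toℕ; toℕ<n; toℕ-fromℕ<)
open import Data.Vec using (Vec; []; _∷_; lookup; tabulate)
open import Data.Vec.Properties using (lookup∘tabulate; tabulate∘lookup; tabulate-cong; ∷-injective)
open import Data.List using (List; []; _∷_; map; filter; length; allFin; concatMap; cartesianProductWith; _++_)
open import Data.List.Properties using (length-map)
open import Data.List.Membership.Propositional using (_∈_)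
open import Data.List.Membership.Propositional.Properties using (∈-map⁺; ∈-map⁻; ∈-filter⁺; ∈-filter⁻; ∈-allFin; ∈-cartesianProductWith⁺)
open import Data.List.Membership.Propositional.Properties.WithK using (unique∧set⇒bag)
open import Data.List.Relation.Unary.Any using (here)
open import Data.List.Relation.Unary.All using (All; [])
open import Data.List.Relation.Unary.All.Properties using (tabulate⁺; tabulate⁻)
open import Data.List.Relation.Unary.AllPairs using ([]; _∷_)
open import Data.List.Relation.Unary.Unique.Propositional using (Unique)
open import Data.List.Relation.Unary.Unique.Propositional.Properties using (map⁺; filter⁺; allFin⁺; cartesianProductWith⁺)
open import Data.List.Relation.Binary.BagAndSetEquality using (∼bag⇒↭)
open import Data.List.Relation.Binary.Permutation.Propositional.Properties using (↭-length)
open import Data.Product using (_×_; _,_)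
open import Function.Bundles using (_⇔_; mk⇔; Equivalence)
open import Relation.Binary.PropositionalEquality using (_≡_; _≗_; refl; sym; trans; cong; subst; module ≡-Reasoning)
open import Relation.Unary using (Decidable)

open Equivalence using (to; from)

same-members⇒same-length : {A : Set} {xs ys : List A} → Unique xs → Unique ys →
  (∀ {z} → z ∈ xs ⇔ z ∈ ys) → length xs ≡ length ys
same-members⇒same-length uxs uys same = ↭-length (∼bag⇒↭ (unique∧set⇒bag uxs uys same))

-- The enumeration  allVecs n w  lists every vector exactly once; its
-- recursive step is a cartesian product, whose library lemmas apply.
allVecs-as-product : (n w : ℕ) →
  allVecs (suc n) w ≡ cartesianProductWith _∷_ (allFin w) (allVecs n w)
allVecs-as-product n w = go (allFin w)
  where
  go : (xs : List (Fin w)) →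
    concatMap (λ x → map (x ∷_) (allVecs n w)) xs ≡ cartesianProductWith _∷_ xs (allVecs n w)
  go []       = refl
  go (x ∷ xs) = cong (map (x ∷_) (allVecs n w) ++_) (go xs)

allVecs-unique : (n w : ℕ) → Unique (allVecs n w)
allVecs-unique zero    w = [] ∷ []
allVecs-unique (suc n) w = subst Unique (sym (allVecs-as-product n w))
  (cartesianProductWith⁺ _∷_ ∷-injective (allFin⁺ w) (allVecs-unique n w))

allVecs-complete : (n w : ℕ) (a : Vec (Fin w) n) → a ∈ allVecs n w
allVecs-complete zero    w []      = here refl
allVecs-complete (suc n) w (x ∷ a) = subst ((x ∷ a) ∈_) (sym (allVecs-as-product n w))
  (∈-cartesianProductWith⁺ _∷_ (∈-allFin x) (allVecs-complete n w a))

∈-filter-allVecs : {n w : ℕ} {P : Vec (Fin w) n → Set} (P? : Decidable P) (a : Vec (Fin w) n) →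
  a ∈ filter P? (allVecs n w) ⇔ P a
∈-filter-allVecs {n} {w} P? a = mk⇔
  (λ a∈ → let _ , pa = ∈-filter⁻ P? {xs = allVecs n w} a∈ in pa)
  (∈-filter⁺ P? (allVecs-complete n w a))

-- Relations along a sequence: R holds between every term and the term s
-- places later.  Periodicity and the descent condition are instances.
Along : {A : Set} → (A → A → Set) → ℕ → (ℕ → A) → Set
Along R s u = ∀ j → R (u (j + s)) (u j)

Periodic : {A : Set} → (ℕ → A) → ℕ → Set
Periodic u p = Along _≡_ p u

along-resp : {A : Set} (R : A → A → Set) (s : ℕ) {u v : ℕ → A} →
  u ≗ v → Along R s u → Along R s v
along-resp R s {u} {v} u≗v along j =
  subst (λ x → R x (v j)) (u≗v (j + s)) (subst (R (u (j + s))) (u≗v j) (along j))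

module _ {A : Set} {u : ℕ → A} {p : ℕ} (per : Periodic u p) where

  periodic-multiple : ∀ m j → u (j + m * p) ≡ u j
  periodic-multiple zero    j = cong u (+-identityʳ j)
  periodic-multiple (suc m) j = begin
    u (j + (p + m * p)) ≡⟨ cong u (trans (cong (j +_) (+-comm p (m * p))) (sym (+-assoc j (m * p) p))) ⟩
    u (j + m * p + p)   ≡⟨ per (j + m * p) ⟩
    u (j + m * p)       ≡⟨ periodic-multiple m j ⟩
    u j                 ∎
    where open ≡-Reasoning

  periodic-∣ : ∀ {q} → p ∣ q → Periodic u q
  periodic-∣ (divides m refl) = periodic-multiple m

  periodic-mod : .{{_ : NonZero p}} → ∀ j → u (j % p) ≡ u j
  periodic-mod j = trans (sym (periodic-multiple (j / p) (j % p))) (cong u (sym (m≡m%n+[m/n]*n j p)))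

  periodic-shift : ∀ s → Periodic (λ j → u (j + s)) p
  periodic-shift s j = trans (cong u (trans (+-assoc j p s)
    (trans (cong (j +_) (+-comm p s)) (sym (+-assoc j s p))))) (per (j + s))

periodic-bezout : {A : Set} {u : ℕ → A} {p q d : ℕ} → Periodic u p → Periodic u q →
  ∀ x y → d + y * q ≡ x * p → Periodic u d
periodic-bezout {u = u} {p} {q} {d} per-p per-q x y eq j = begin
  u (j + d)           ≡⟨ periodic-multiple per-q y (j + d) ⟨
  u (j + d + y * q)   ≡⟨ cong u (trans (+-assoc j d (y * q)) (cong (j +_) eq)) ⟩
  u (j + x * p)       ≡⟨ periodic-multiple per-p x j ⟩
  u j                 ∎
  where open ≡-Reasoning

periodic-gcd : {A : Set} {u : ℕ → A} {p q : ℕ} → Periodic u p → Periodic u q → Periodic u (gcd p q)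
periodic-gcd {p = p} {q} per-p per-q with Bézout.identity (gcd-GCD p q)
... | Bézout.+- x y eq = periodic-bezout per-p per-q x y eq
... | Bézout.-+ x y eq = periodic-bezout per-q per-p y x eq

module _ {A : Set} where

  cyc : {m : ℕ} .{{_ : NonZero m}} → Vec A m → ℕ → A
  cyc {m} a j = lookup a (fromℕ< (m%n<n j m))

  first : (m : ℕ) → (ℕ → A) → Vec A m
  first m u = tabulate (λ i → u (toℕ i))

  cyc-periodic : {m : ℕ} .{{_ : NonZero m}} (a : Vec A m) → Periodic (cyc a) m
  cyc-periodic {m} a j = cong (lookup a) (fromℕ<-cong _ _ ([m+n]%n≡m%n j m) (m%n<n (j + m) m) (m%n<n j m))

  cyc-toℕ : {m : ℕ} .{{_ : NonZero m}} (a : Vec A m) (i : Fin m) → cyc a (toℕ i) ≡ lookup a i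
  cyc-toℕ {m} a i = cong (lookup a)
    (trans (fromℕ<-cong _ _ (m<n⇒m%n≡m (toℕ<n i)) (m%n<n (toℕ i) m) (toℕ<n i))
           (fromℕ<-toℕ i (toℕ<n i)))

  first-cyc : {m : ℕ} .{{_ : NonZero m}} (a : Vec A m) → first m (cyc a) ≡ a
  first-cyc a = trans (tabulate-cong (cyc-toℕ a)) (tabulate∘lookup a)

  cyc-first : {m : ℕ} .{{_ : NonZero m}} {u : ℕ → A} → Periodic u m → cyc (first m u) ≗ u
  cyc-first {m} {u} per j =
    trans (lookup∘tabulate (λ i → u (toℕ i)) _)
          (trans (cong u (toℕ-fromℕ< (m%n<n j m))) (periodic-mod per j))

  all-positions⇔along : {m : ℕ} .{{_ : NonZero m}} (R : A → A → Set) (s : ℕ) (a : Vec A m) →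
    All (λ i → R (lookup a (shiftIdx m i s)) (lookup a i)) (allFin m) ⇔ Along R s (cyc a)
  all-positions⇔along {m} R s a = mk⇔ to-along from-along
    where
    to-along : All (λ i → R (lookup a (shiftIdx m i s)) (lookup a i)) (allFin m) → Along R s (cyc a)
    to-along all j = subst (λ x → R x (cyc a j)) shift-eq (tabulate⁻ all (fromℕ< (m%n<n j m)))
      where
      shift-eq : cyc a (toℕ (fromℕ< (m%n<n j m)) + s) ≡ cyc a (j + s)
      shift-eq = trans (cong (λ t → cyc a (t + s)) (toℕ-fromℕ< (m%n<n j m)))
                       (periodic-mod (periodic-shift (cyc-periodic a) s) j)

    from-along : Along R s (cyc a) → All (λ i → R (lookup a (shiftIdx m i s)) (lookup a i)) (allFin m)
    from-along along = tabulate⁺ (λ i → subst (R (cyc a (toℕ i + s))) (cyc-toℕ a i) (along (toℕ i)))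

Descent : {w : ℕ} → Fin w → Fin w → Set
Descent x y = toℕ x ≤ suc (toℕ y)

module _ {m w : ℕ} .{{_ : NonZero m}} (a : Vec (Fin w) m) where

  isCDP⇔descent : IsCDP m w a ⇔ Along Descent 1 (cyc a)
  isCDP⇔descent = all-positions⇔along Descent 1 a

  isFixedBy⇔periodic : ∀ k → IsFixedBy m w k a ⇔ Periodic (cyc a) k
  isFixedBy⇔periodic k = all-positions⇔along _≡_ k a

module Correspondence (n w k : ℕ) {{nz : NonZero n}} {{dz : NonZero (gcd n k)}} where

  d : ℕ
  d = gcd n k

  restrict : Vec (Fin w) n → Vec (Fin w) d
  restrict a = first d (cyc a)

  extend : Vec (Fin w) d → Vec (Fin w) n
  extend b = first n (cyc b)

  -- Since d divides n, the sequence spelled out by a d-vector is n-periodic,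
  -- so repeating its first n terms reproduces it.
  cyc-extend : (b : Vec (Fin w) d) → cyc (extend b) ≗ cyc b
  cyc-extend b = cyc-first (periodic-∣ (cyc-periodic b) (gcd[m,n]∣m n k))

  restrict-extend : (b : Vec (Fin w) d) → restrict (extend b) ≡ b
  restrict-extend b = trans (tabulate-cong (λ i → cyc-extend b (toℕ i))) (first-cyc b)

  extend-injective : ∀ {b b′} → extend b ≡ extend b′ → b ≡ b′
  extend-injective {b} {b′} eq = begin
    b                      ≡⟨ restrict-extend b ⟨
    restrict (extend b)    ≡⟨ cong restrict eq ⟩
    restrict (extend b′)   ≡⟨ restrict-extend b′ ⟩
    b′                     ∎
    where open ≡-Reasoning

  fixed⇒d-periodic : (a : Vec (Fin w) n) → IsFixedBy n w k a → Periodic (cyc a) d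
  fixed⇒d-periodic a fixed = periodic-gcd (cyc-periodic a) (to (isFixedBy⇔periodic a k) fixed)

  extend-restrict : (a : Vec (Fin w) n) → IsFixedBy n w k a → extend (restrict a) ≡ a
  extend-restrict a fixed =
    trans (tabulate-cong (λ i → cyc-first (fixed⇒d-periodic a fixed) (toℕ i))) (first-cyc a)

  restrict-CDP : (a : Vec (Fin w) n) → IsCDP n w a → IsFixedBy n w k a → IsCDP d w (restrict a)
  restrict-CDP a cdp fixed = from (isCDP⇔descent (restrict a))
    (along-resp Descent 1 (λ j → sym (cyc-first (fixed⇒d-periodic a fixed) j)) (to (isCDP⇔descent a) cdp))

  extend-CDP : (b : Vec (Fin w) d) → IsCDP d w b → IsCDP n w (extend b)
  extend-CDP b cdp = from (isCDP⇔descent (extend b))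
    (along-resp Descent 1 (λ j → sym (cyc-extend b j)) (to (isCDP⇔descent b) cdp))

  extend-fixed : (b : Vec (Fin w) d) → IsFixedBy n w k (extend b)
  extend-fixed b = from (isFixedBy⇔periodic (extend b) k)
    (along-resp _≡_ k (λ j → sym (cyc-extend b j)) (periodic-∣ (cyc-periodic b) (gcd[m,n]∣n n k)))

  fixedCDPs : List (Vec (Fin w) n)
  fixedCDPs = filter (isFixedBy? n w k) (filter (isCDP? n w) (allVecs n w))

  CDPs : List (Vec (Fin w) d)
  CDPs = filter (isCDP? d w) (allVecs d w)

  ∈-fixedCDPs : (a : Vec (Fin w) n) → a ∈ fixedCDPs ⇔ (IsCDP n w a × IsFixedBy n w k a)
  ∈-fixedCDPs a = mk⇔
    (λ a∈ → let a∈cdps , fixed = ∈-filter⁻ (isFixedBy? n w k) {xs = filter (isCDP? n w) (allVecs n w)} a∈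
            in to (∈-filter-allVecs (isCDP? n w) a) a∈cdps , fixed)
    (λ (cdp , fixed) → ∈-filter⁺ (isFixedBy? n w k) (from (∈-filter-allVecs (isCDP? n w) a) cdp) fixed)

  fixedCDPs≈extensions : ∀ {a} → a ∈ fixedCDPs ⇔ a ∈ map extend CDPs
  fixedCDPs≈extensions {a} = mk⇔ to-ext from-ext
    where
    to-ext : a ∈ fixedCDPs → a ∈ map extend CDPs
    to-ext a∈ = let cdp , fixed = to (∈-fixedCDPs a) a∈ in
      subst (_∈ map extend CDPs) (extend-restrict a fixed)
        (∈-map⁺ extend (from (∈-filter-allVecs (isCDP? d w) (restrict a)) (restrict-CDP a cdp fixed)))

    from-ext : a ∈ map extend CDPs → a ∈ fixedCDPs
    from-ext a∈ with ∈-map⁻ extend a∈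
    ... | b , b∈ , refl =
      from (∈-fixedCDPs (extend b)) (extend-CDP b (to (∈-filter-allVecs (isCDP? d w) b) b∈) , extend-fixed b)

  -- Both lists are duplicate-free (extend is injective), so equal membership
  -- gives equal length.
  count : length fixedCDPs ≡ length CDPs
  count = trans
    (same-members⇒same-length
      (filter⁺ (isFixedBy? n w k) (filter⁺ (isCDP? n w) (allVecs-unique n w)))
      (map⁺ extend-injective (filter⁺ (isCDP? d w) (allVecs-unique d w)))
      fixedCDPs≈extensions)
    (length-map extend CDPs)

lemma4p2 : (n w k : ℕ) → 1 ≤ n → 1 ≤ w → 1 ≤ k → k ≤ n → (nz : NonZero n) → (dz : NonZero (gcd n k)) →
    cardCDPk n w k {{nz}} ≡ cardCDP (gcd n k) w {{dz}}
lemma4p2 n w k _ _ _ _ nz dz = Correspondence.count n w k {{nz}} {{dz}}
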